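{- Let $G$ be a finite simple graph, let $S\in\mathrm{MaxCritIndep}(G)$ and let $X=N[S]$. Then $\mathrm{MaxCritIndep}(G)\vartriangleleft\Omega(G[X])$; that is, $\bigcup\mathrm{MaxCritIndep}(G)\subseteq\bigcup\Omega(G[X])$ and $\bigcap\Omega(G[X])\subseteq\bigcap\mathrm{MaxCritIndep}(G)$.
   Context: For a graph $G$ and $A\subseteq V(G)$: $N(A)=\{v\in V(G): v \text{ has a neighbor in } A\}$, $N[A]=N(A)\cup A$, and $G[A]$ is the subgraph induced by $A$. A set is independent if no two of its vertices are adjacent; $\mathrm{Ind}(G)$ is the family of independent sets, $\alpha(G)$ the maximum size of an independent set, and $\Omega(G)$ the family of all maximum independent sets. The difference of $X\subseteq V(G)$ is $d(X)=|X|-|N(X)|$. An independent set $A$ is critical if $d(A)=\max\{d(I):I\in\mathrm{Ind}(G)\}$. A maximum critical independent set is a critical independent set of maximum cardinality among all critical independent sets; $\mathrm{MaxCritIndep}(G)$ denotes the family of all of them. For collections of sets $\Gamma,\Gamma'$, write $\Gamma'\vartriangleleft\Gamma$ if $\bigcup\Gamma'\subseteq\bigcup\Gamma$ and $\bigcap\Gamma\subseteq\bigcap\Gamma'$. -}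

module Defs where

open import Data.Nat using (ℕ; _≤_)
open import Data.Bool using (Bool; true; false; _∧_)
open import Data.Fin using (Fin)
open import Data.Fin.Subset using (Subset; _∈_; _⊆_; _∪_; ∣_∣)
open import Data.List using (allFin)
open import Data.Bool.ListAction using (any)
open import Data.Vec using (tabulate; lookup)
open import Data.Integer as ℤ using (ℤ; +_; _-_)
open import Data.Product using (_×_; ∃-syntax)
open import Relation.Binary.PropositionalEquality using (_≡_)

record Graph (n : ℕ) : Set where
  field
    adj     : Fin n → Fin n → Bool
    sym     : ∀ u v → adj u v ≡ adj v u
    irrefl  : ∀ v → adj v v ≡ false
open Graph public

module _ {n : ℕ} (G : Graph n) where

  N : Subset n → Subset n
  N A = tabulate λ v → any (λ u → lookup A u ∧ adj G u v) (allFin n)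

  N[_] : Subset n → Subset n
  N[ A ] = N A ∪ A

  Independent : Subset n → Set
  Independent A = ∀ u v → u ∈ A → v ∈ A → adj G u v ≡ false

  d : Subset n → ℤ
  d X = + ∣ X ∣ - + ∣ N X ∣

  Critical : Subset n → Set
  Critical A = Independent A × (∀ I → Independent I → d I ℤ.≤ d A)

  MaxCritIndep : Subset n → Set
  MaxCritIndep S = Critical S × (∀ T → Critical T → ∣ T ∣ ≤ ∣ S ∣)

  -- Independent sets of the induced subgraph G[X] are exactly the subsets
  -- of X independent in G (vertices of G[X] keep their names in G).
  IndependentIn : Subset n → Subset n → Set
  IndependentIn X A = A ⊆ X × Independent A

  MaxIndepIn : Subset n → Subset n → Set
  MaxIndepIn X A = IndependentIn X A × (∀ J → IndependentIn X J → ∣ J ∣ ≤ ∣ A ∣)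

module Submission where

-- Every maximum critical independent set T of G is a maximum independent
-- set of G[N[S]], where S is any fixed maximum critical independent set.

open import Defs hiding (sym)
open import Data.Nat using (ℕ; suc; _+_; _≤_)
import Data.Nat.Properties as ℕP
open import Data.Fin using (Fin)
open import Data.Bool using (true; false)
open import Data.Bool.Properties using (T-≡; T-∧; ¬-not)
open import Data.Fin.Subset
  using (Subset; inside; outside; _∈_; _∉_; _⊆_; _⊂_; _∪_; _∩_; ∁; Empty; ∣_∣)
open import Data.Fin.Subset.Properties
  using (_∈?_; x∈p∪q⁺; x∈p∪q⁻; x∈p∩q⁺; x∈p∩q⁻; x∈∁p⇒x∉p; x∉p⇒x∈∁p;
         p⊆q⇒∣p∣≤∣q∣; p⊂q⇒∣p∣<∣q∣; Empty-unique; ∣⊥∣≡0)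
open import Data.Vec using ([]; _∷_)
open import Data.Vec.Properties using (lookup∘tabulate; []=⇒lookup; lookup⇒[]=)
open import Data.List using (allFin)
open import Data.List.Membership.Propositional using (lose)
open import Data.List.Membership.Propositional.Properties using (∈-allFin)
open import Data.List.Relation.Unary.Any using (satisfied)
open import Data.List.Relation.Unary.Any.Properties using (any⁺; any⁻)
open import Data.Integer as ℤ using (ℤ; +_; _-_; -_; +≤+)
import Data.Integer.Properties as ℤP
open import Data.Integer.Tactic.RingSolver using (solve-∀)
open import Data.Product using (_×_; ∃-syntax; _,_; proj₁; proj₂)
open import Data.Sum using (inj₁; inj₂)
open import Data.Empty using (⊥)
open import Function using (Equivalence; _∘_)
open import Relation.Nullary using (yes; no; contradiction)
open import Relation.Binary.PropositionalEquality
  using (_≡_; refl; sym; trans; cong; subst₂; module ≡-Reasoning)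

∣p∪q∣+∣p∩q∣≡∣p∣+∣q∣ : ∀ {n} (p q : Subset n) → ∣ p ∪ q ∣ + ∣ p ∩ q ∣ ≡ ∣ p ∣ + ∣ q ∣
∣p∪q∣+∣p∩q∣≡∣p∣+∣q∣ [] [] = refl
∣p∪q∣+∣p∩q∣≡∣p∣+∣q∣ (inside ∷ p) (inside ∷ q) = cong suc (begin
  ∣ p ∪ q ∣ + suc (∣ p ∩ q ∣)  ≡⟨ ℕP.+-suc (∣ p ∪ q ∣) (∣ p ∩ q ∣) ⟩
  suc (∣ p ∪ q ∣ + ∣ p ∩ q ∣)  ≡⟨ cong suc (∣p∪q∣+∣p∩q∣≡∣p∣+∣q∣ p q) ⟩
  suc (∣ p ∣ + ∣ q ∣)          ≡⟨ ℕP.+-suc (∣ p ∣) (∣ q ∣) ⟨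
  ∣ p ∣ + suc (∣ q ∣)          ∎)
  where open ≡-Reasoning
∣p∪q∣+∣p∩q∣≡∣p∣+∣q∣ (inside ∷ p) (outside ∷ q) = cong suc (∣p∪q∣+∣p∩q∣≡∣p∣+∣q∣ p q)
∣p∪q∣+∣p∩q∣≡∣p∣+∣q∣ (outside ∷ p) (inside ∷ q) =
  trans (cong suc (∣p∪q∣+∣p∩q∣≡∣p∣+∣q∣ p q)) (sym (ℕP.+-suc (∣ p ∣) (∣ q ∣)))
∣p∪q∣+∣p∩q∣≡∣p∣+∣q∣ (outside ∷ p) (outside ∷ q) = ∣p∪q∣+∣p∩q∣≡∣p∣+∣q∣ p q

cover-≤ : ∀ {n} {p q r : Subset n} → p ⊆ q ∪ r → ∣ p ∣ ≤ ∣ q ∣ + ∣ r ∣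
cover-≤ {q = q} {r} p⊆q∪r =
  ℕP.≤-trans (p⊆q⇒∣p∣≤∣q∣ p⊆q∪r)
    (ℕP.≤-trans (ℕP.m≤m+n (∣ q ∪ r ∣) (∣ q ∩ r ∣)) (ℕP.≤-reflexive (∣p∪q∣+∣p∩q∣≡∣p∣+∣q∣ q r)))

disjoint-≤ : ∀ {n} {p q e : Subset n} → p ⊆ e → q ⊆ e → (∀ {x} → x ∈ p → x ∉ q) →
             ∣ p ∣ + ∣ q ∣ ≤ ∣ e ∣
disjoint-≤ {n} {p} {q} {e} p⊆e q⊆e disjoint = begin
  ∣ p ∣ + ∣ q ∣          ≡⟨ ∣p∪q∣+∣p∩q∣≡∣p∣+∣q∣ p q ⟨
  ∣ p ∪ q ∣ + ∣ p ∩ q ∣  ≡⟨ cong (λ k → ∣ p ∪ q ∣ + k) ∣p∩q∣≡0 ⟩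
  ∣ p ∪ q ∣ + 0          ≡⟨ ℕP.+-identityʳ (∣ p ∪ q ∣) ⟩
  ∣ p ∪ q ∣              ≤⟨ p⊆q⇒∣p∣≤∣q∣ p∪q⊆e ⟩
  ∣ e ∣                  ∎
  where
  open ℕP.≤-Reasoning
  p∩q-empty : Empty (p ∩ q)
  p∩q-empty (x , x∈p∩q) = let (x∈p , x∈q) = x∈p∩q⁻ p q x∈p∩q in disjoint x∈p x∈q
  ∣p∩q∣≡0 : ∣ p ∩ q ∣ ≡ 0
  ∣p∩q∣≡0 = trans (cong ∣_∣ (Empty-unique p∩q-empty)) (∣⊥∣≡0 n)
  p∪q⊆e : p ∪ q ⊆ e
  p∪q⊆e x∈p∪q with x∈p∪q⁻ p q x∈p∪q
  ... | inj₁ x∈p = p⊆e x∈p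
  ... | inj₂ x∈q = q⊆e x∈q

exchange-≤ : ∀ {n} {a b c e f : Subset n} → a ⊆ b ∪ c → c ⊆ e → f ⊆ e →
             (∀ {x} → x ∈ c → x ∉ f) → ∣ a ∣ + ∣ f ∣ ≤ ∣ b ∣ + ∣ e ∣
exchange-≤ {a = a} {b} {c} {e} {f} a⊆b∪c c⊆e f⊆e disjoint = begin
  ∣ a ∣ + ∣ f ∣            ≤⟨ ℕP.+-monoˡ-≤ (∣ f ∣) (cover-≤ a⊆b∪c) ⟩
  (∣ b ∣ + ∣ c ∣) + ∣ f ∣  ≡⟨ ℕP.+-assoc (∣ b ∣) (∣ c ∣) (∣ f ∣) ⟩
  ∣ b ∣ + (∣ c ∣ + ∣ f ∣)  ≤⟨ ℕP.+-monoʳ-≤ (∣ b ∣) (disjoint-≤ c⊆e f⊆e disjoint) ⟩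
  ∣ b ∣ + ∣ e ∣            ∎
  where open ℕP.≤-Reasoning

diff-≤⁺ : ∀ a b c e → a + e ≤ c + b → + a - + b ℤ.≤ + c - + e
diff-≤⁺ a b c e a+e≤c+b =
  subst₂ ℤ._≤_ (shift (+ a) (+ b) (+ e)) (shift′ (+ c) (+ b) (+ e))
    (ℤP.+-monoˡ-≤ (- (+ b ℤ.+ + e)) (+≤+ a+e≤c+b))
  where
  shift : ∀ (x y z : ℤ) → (x ℤ.+ z) - (y ℤ.+ z) ≡ x - y
  shift = solve-∀
  shift′ : ∀ (x y z : ℤ) → (x ℤ.+ y) - (y ℤ.+ z) ≡ x - z
  shift′ = solve-∀

diff-≤⁻ : ∀ a b c e → + a - + b ℤ.≤ + c - + e → a + e ≤ c + b
diff-≤⁻ a b c e a-b≤c-e =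
  ℤP.drop‿+≤+ (subst₂ ℤ._≤_ (unshift (+ a) (+ b) (+ e)) (unshift′ (+ c) (+ b) (+ e))
    (ℤP.+-monoˡ-≤ (+ b ℤ.+ + e) a-b≤c-e))
  where
  unshift : ∀ (x y z : ℤ) → (x - y) ℤ.+ (y ℤ.+ z) ≡ x ℤ.+ z
  unshift = solve-∀
  unshift′ : ∀ (x y z : ℤ) → (x - z) ℤ.+ (y ℤ.+ z) ≡ x ℤ.+ y
  unshift′ = solve-∀

ℤ-+-cancelʳ-≤ : ∀ (i j k : ℤ) → i ℤ.+ k ℤ.≤ j ℤ.+ k → i ℤ.≤ j
ℤ-+-cancelʳ-≤ i j k i+k≤j+k =
  subst₂ ℤ._≤_ (cancel i k) (cancel j k) (ℤP.+-monoˡ-≤ (- k) i+k≤j+k)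
  where
  cancel : ∀ (x z : ℤ) → (x ℤ.+ z) - z ≡ x
  cancel = solve-∀

module _ {n : ℕ} (G : Graph n) where

  edge-sym : ∀ {u v} → adj G u v ≡ true → adj G v u ≡ true
  edge-sym {u} {v} uv = trans (Graph.sym G v u) uv

  edge-absurd : ∀ {u v} → adj G u v ≡ true → adj G u v ≡ false → ⊥
  edge-absurd uv uv-false with trans (sym uv) uv-false
  ... | ()

  ∈N⁺ : ∀ {A u v} → u ∈ A → adj G u v ≡ true → v ∈ N G A
  ∈N⁺ {A} {u} {v} u∈A uv = lookup⇒[]= v (N G A)
    (trans (lookup∘tabulate _ v)
      (Equivalence.to T-≡ (any⁺ _ (lose (∈-allFin u)
        (Equivalence.from T-∧ (Equivalence.from T-≡ ([]=⇒lookup u∈A) , Equivalence.from T-≡ uv))))))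

  ∈N⁻ : ∀ {A v} → v ∈ N G A → ∃[ u ] (u ∈ A × adj G u v ≡ true)
  ∈N⁻ {A} {v} v∈NA
    with satisfied (any⁻ _ (allFin n)
           (Equivalence.from T-≡ (trans (sym (lookup∘tabulate _ v)) ([]=⇒lookup v∈NA))))
  ... | u , T[u∈A∧uv] =
    let (T[u∈A] , T[uv]) = Equivalence.to T-∧ T[u∈A∧uv]
    in u , lookup⇒[]= u A (Equivalence.to T-≡ T[u∈A]) , Equivalence.to T-≡ T[uv]

  N-mono : ∀ {A B} → A ⊆ B → N G A ⊆ N G B
  N-mono A⊆B v∈NA = let (u , u∈A , uv) = ∈N⁻ v∈NA in ∈N⁺ (A⊆B u∈A) uv

  -- ∣N∣ is submodular: N(A ∪ B) ⊆ N(A) ∪ N(B) and N(A ∩ B) ⊆ N(A) ∩ N(B).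
  N-submodular : ∀ A B → ∣ N G (A ∪ B) ∣ + ∣ N G (A ∩ B) ∣ ≤ ∣ N G A ∣ + ∣ N G B ∣
  N-submodular A B =
    ℕP.≤-trans (ℕP.+-mono-≤ (p⊆q⇒∣p∣≤∣q∣ N∪⊆∪N) (p⊆q⇒∣p∣≤∣q∣ N∩⊆∩N))
      (ℕP.≤-reflexive (∣p∪q∣+∣p∩q∣≡∣p∣+∣q∣ (N G A) (N G B)))
    where
    N∪⊆∪N : N G (A ∪ B) ⊆ N G A ∪ N G B
    N∪⊆∪N v∈N[A∪B] with ∈N⁻ v∈N[A∪B]
    ... | u , u∈A∪B , uv with x∈p∪q⁻ A B u∈A∪B
    ...   | inj₁ u∈A = x∈p∪q⁺ (inj₁ (∈N⁺ u∈A uv))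
    ...   | inj₂ u∈B = x∈p∪q⁺ (inj₂ (∈N⁺ u∈B uv))
    N∩⊆∩N : N G (A ∩ B) ⊆ N G A ∩ N G B
    N∩⊆∩N v∈N[A∩B] =
      x∈p∩q⁺ (N-mono (proj₁ ∘ x∈p∩q⁻ A B) v∈N[A∩B] , N-mono (proj₂ ∘ x∈p∩q⁻ A B) v∈N[A∩B])

  d-supermodular : ∀ A B → d G A ℤ.+ d G B ℤ.≤ d G (A ∪ B) ℤ.+ d G (A ∩ B)
  d-supermodular A B =
    subst₂ ℤ._≤_ (sum-of-diffs (+ ∣ A ∣) (+ ∣ N G A ∣) (+ ∣ B ∣) (+ ∣ N G B ∣))
                 (sum-of-diffs (+ ∣ A ∪ B ∣) (+ ∣ N G (A ∪ B) ∣) (+ ∣ A ∩ B ∣) (+ ∣ N G (A ∩ B) ∣))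
      (diff-≤⁺ (∣ A ∣ + ∣ B ∣) (∣ N G A ∣ + ∣ N G B ∣)
               (∣ A ∪ B ∣ + ∣ A ∩ B ∣) (∣ N G (A ∪ B) ∣ + ∣ N G (A ∩ B) ∣)
        (ℕP.+-mono-≤ (ℕP.≤-reflexive (sym (∣p∪q∣+∣p∩q∣≡∣p∣+∣q∣ A B))) (N-submodular A B)))
    where
    sum-of-diffs : ∀ (a b c e : ℤ) → (a ℤ.+ c) - (b ℤ.+ e) ≡ (a - b) ℤ.+ (c - e)
    sum-of-diffs = solve-∀

  d-grows-by-∪ : ∀ A B → d G (A ∩ B) ℤ.≤ d G B → d G A ℤ.≤ d G (A ∪ B)
  d-grows-by-∪ A B d[A∩B]≤dB =
    ℤ-+-cancelʳ-≤ (d G A) (d G (A ∪ B)) (d G B)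
      (ℤP.≤-trans (d-supermodular A B) (ℤP.+-monoʳ-≤ (d G (A ∪ B)) d[A∩B]≤dB))

  isolated : Subset n → Subset n
  isolated A = A ∩ ∁ (N G A)

  isolated-⊆ : ∀ {A} → isolated A ⊆ A
  isolated-⊆ {A} = proj₁ ∘ x∈p∩q⁻ A (∁ (N G A))

  isolated-no-edge : ∀ {A u v} → u ∈ A → v ∈ isolated A → adj G u v ≡ false
  isolated-no-edge {A} u∈A v∈iso =
    ¬-not λ uv → x∈∁p⇒x∉p (proj₂ (x∈p∩q⁻ A (∁ (N G A)) v∈iso)) (∈N⁺ u∈A uv)

  isolated-independent : ∀ A → Independent G (isolated A)
  isolated-independent A u v u∈iso v∈iso = isolated-no-edge (isolated-⊆ u∈iso) v∈iso

  independent-∪-isolated : ∀ {A U} → A ⊆ U → Independent G A → Independent G (A ∪ isolated U)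
  independent-∪-isolated {A} {U} A⊆U indA u v u∈ v∈
    with x∈p∪q⁻ A (isolated U) u∈ | x∈p∪q⁻ A (isolated U) v∈
  ... | inj₁ u∈A   | inj₁ v∈A   = indA u v u∈A v∈A
  ... | inj₁ u∈A   | inj₂ v∈iso = isolated-no-edge (A⊆U u∈A) v∈iso
  ... | inj₂ u∈iso | inj₁ v∈A   =
    trans (Graph.sym G u v) (isolated-no-edge (A⊆U v∈A) u∈iso)
  ... | inj₂ u∈iso | inj₂ v∈iso = isolated-independent U u v u∈iso v∈iso

  -- Passing to the isolated part does not decrease the difference: the
  -- removed vertices A ∩ N(A) lie in N(A) but not in N(isolated A).
  d-isolated : ∀ A → d G A ℤ.≤ d G (isolated A)
  d-isolated A =
    diff-≤⁺ (∣ A ∣) (∣ N G A ∣) (∣ isolated A ∣) (∣ N G (isolated A) ∣)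
      (exchange-≤ A⊆iso∪removed removed⊆NA (N-mono (isolated-⊆ {A})) disjoint)
    where
    A⊆iso∪removed : A ⊆ isolated A ∪ (A ∩ N G A)
    A⊆iso∪removed {v} v∈A with v ∈? N G A
    ... | yes v∈NA = x∈p∪q⁺ (inj₂ (x∈p∩q⁺ (v∈A , v∈NA)))
    ... | no  v∉NA = x∈p∪q⁺ (inj₁ (x∈p∩q⁺ (v∈A , x∉p⇒x∈∁p v∉NA)))
    removed⊆NA : A ∩ N G A ⊆ N G A
    removed⊆NA = proj₂ ∘ x∈p∩q⁻ A (N G A)
    disjoint : ∀ {v} → v ∈ A ∩ N G A → v ∉ N G (isolated A)
    disjoint v∈removed v∈N[iso] =
      let (u , u∈iso , uv) = ∈N⁻ v∈N[iso]
      in edge-absurd (edge-sym uv) (isolated-no-edge (proj₁ (x∈p∩q⁻ A (N G A) v∈removed)) u∈iso)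

  critical-max : ∀ {S} → Critical G S → ∀ A → d G A ℤ.≤ d G S
  critical-max (_ , maximal) A =
    ℤP.≤-trans (d-isolated A) (maximal (isolated A) (isolated-independent A))

  -- With JN = J ∩ N(S) and W = S ∖ N(JN): J ⊆ W ∪ JN, and N(W), JN are
  -- disjoint inside N(S); combined with d(W) ≤ d(S) this gives ∣J∣ ≤ ∣S∣.
  critical-bounds-independent : ∀ {S J} → Critical G S → IndependentIn G (N[_] G S) J →
                                ∣ J ∣ ≤ ∣ S ∣
  critical-bounds-independent {S} {J} critS (J⊆N[S] , indJ) =
    ℕP.+-cancelʳ-≤ (∣ N G W ∣) (∣ J ∣) (∣ S ∣) (ℕP.≤-trans exchanged dW≤dS)
    where
    JN W : Subset n
    JN = J ∩ N G S
    W = S ∩ ∁ (N G JN)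
    dW≤dS : ∣ W ∣ + ∣ N G S ∣ ≤ ∣ S ∣ + ∣ N G W ∣
    dW≤dS = diff-≤⁻ (∣ W ∣) (∣ N G W ∣) (∣ S ∣) (∣ N G S ∣) (critical-max critS W)
    J⊆W∪JN : J ⊆ W ∪ JN
    J⊆W∪JN {j} j∈J with x∈p∪q⁻ (N G S) S (J⊆N[S] j∈J)
    ... | inj₁ j∈NS = x∈p∪q⁺ (inj₂ (x∈p∩q⁺ (j∈J , j∈NS)))
    ... | inj₂ j∈S  = x∈p∪q⁺ (inj₁ (x∈p∩q⁺ (j∈S , x∉p⇒x∈∁p j∉N[JN])))
      where
      j∉N[JN] : j ∉ N G JN
      j∉N[JN] j∈N[JN] =
        let (u , u∈JN , uj) = ∈N⁻ j∈N[JN]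
        in edge-absurd uj (indJ _ _ (proj₁ (x∈p∩q⁻ J (N G S) u∈JN)) j∈J)
    JN⊆NS : JN ⊆ N G S
    JN⊆NS = proj₂ ∘ x∈p∩q⁻ J (N G S)
    disjoint : ∀ {v} → v ∈ JN → v ∉ N G W
    disjoint v∈JN v∈NW =
      let (w , w∈W , wv) = ∈N⁻ v∈NW
      in x∈∁p⇒x∉p (proj₂ (x∈p∩q⁻ S (∁ (N G JN)) w∈W)) (∈N⁺ v∈JN (edge-sym wv))
    exchanged : ∣ J ∣ + ∣ N G W ∣ ≤ ∣ W ∣ + ∣ N G S ∣
    exchanged = exchange-≤ J⊆W∪JN JN⊆NS (N-mono (proj₁ ∘ x∈p∩q⁻ S (∁ (N G JN)))) disjoint

  -- Extension: if a critical T has a vertex t outside N[S], then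
  -- Z = S ∪ isolated (T ∪ S) is a critical independent set strictly above S.
  critical-extension : ∀ {S T t} → Critical G S → Critical G T → t ∈ T → t ∉ N[_] G S →
                       ∃[ Z ] (Critical G Z × S ⊂ Z)
  critical-extension {S} {T} {t} critS@(indS , maxS) critT@(indT , _) t∈T t∉N[S] =
    Z , (Z-independent , λ I indI → ℤP.≤-trans (maxS I indI) dS≤dZ) ,
    ((λ s∈S → x∈p∪q⁺ (inj₁ s∈S)) , t , t∈Z , t∉N[S] ∘ x∈p∪q⁺ ∘ inj₂)
    where
    U Z : Subset n
    U = T ∪ S
    Z = S ∪ isolated U
    dT≤dU : d G T ℤ.≤ d G U
    dT≤dU = d-grows-by-∪ T S (critical-max critS (T ∩ S))
    dS≤dZ : d G S ℤ.≤ d G Z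
    dS≤dZ = d-grows-by-∪ S (isolated U)
      (ℤP.≤-trans (critical-max critT (S ∩ isolated U)) (ℤP.≤-trans dT≤dU (d-isolated U)))
    Z-independent : Independent G Z
    Z-independent = independent-∪-isolated (λ s∈S → x∈p∪q⁺ (inj₂ s∈S)) indS
    t∉NU : t ∉ N G U
    t∉NU t∈NU with ∈N⁻ t∈NU
    ... | u , u∈U , ut with x∈p∪q⁻ T S u∈U
    ...   | inj₁ u∈T = edge-absurd ut (indT u t u∈T t∈T)
    ...   | inj₂ u∈S = t∉N[S] (x∈p∪q⁺ (inj₁ (∈N⁺ u∈S ut)))
    t∈Z : t ∈ Z
    t∈Z = x∈p∪q⁺ (inj₂ (x∈p∩q⁺ (x∈p∪q⁺ (inj₁ t∈T) , x∉p⇒x∈∁p t∉NU)))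

  critical-⊆-N[S] : ∀ {S T} → MaxCritIndep G S → Critical G T → T ⊆ N[_] G S
  critical-⊆-N[S] {S} (critS , largest) critT {t} t∈T with t ∈? N[_] G S
  ... | yes t∈N[S] = t∈N[S]
  ... | no  t∉N[S] =
    let (Z , critZ , S⊂Z) = critical-extension critS critT t∈T t∉N[S]
    in contradiction (largest Z critZ) (ℕP.<⇒≱ (p⊂q⇒∣p∣<∣q∣ S⊂Z))

  maxCrit⇒maxIndep : ∀ {S T} → MaxCritIndep G S → MaxCritIndep G T → MaxIndepIn G (N[_] G S) T
  maxCrit⇒maxIndep mS@(critS , _) (critT@(indT , _) , largestT) =
    (critical-⊆-N[S] mS critT , indT) ,
    λ J indJ → ℕP.≤-trans (critical-bounds-independent critS indJ) (largestT _ critS)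

lemma2p1 : (n : ℕ) (G : Graph n) (S : Subset n) → MaxCritIndep G S →
    ((v : Fin n) → (∃[ T ] (MaxCritIndep G T × v ∈ T)) →
       ∃[ I ] (MaxIndepIn G (N[_] G S) I × v ∈ I))
    × ((v : Fin n) → ((I : Subset n) → MaxIndepIn G (N[_] G S) I → v ∈ I) →
       (T : Subset n) → MaxCritIndep G T → v ∈ T)
lemma2p1 n G S mS = union-covered , intersection-contained
  where
  union-covered : (v : Fin n) → ∃[ T ] (MaxCritIndep G T × v ∈ T) →
                  ∃[ I ] (MaxIndepIn G (N[_] G S) I × v ∈ I)
  union-covered v (T , mT , v∈T) = T , maxCrit⇒maxIndep G mS mT , v∈T
  intersection-contained : (v : Fin n) → ((I : Subset n) → MaxIndepIn G (N[_] G S) I → v ∈ I) →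
                           (T : Subset n) → MaxCritIndep G T → v ∈ T
  intersection-contained v in-every-I T mT = in-every-I T (maxCrit⇒maxIndep G mS mT)
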